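{- Let $f\colon \tilde G\to G$ be a covering projection of graphs. If $G$ admits a strong edge coloring with $n$ colors for some integer $n$, then so does $\tilde G$.
   Context: A strong edge coloring of a graph is a proper edge coloring with no bichromatic path of length three (equivalently, each color class is an induced matching). A surjective graph homomorphism $f\colon\tilde G\to G$ is a covering projection if for every vertex $\tilde v$ of $\tilde G$ the set of edges incident with $\tilde v$ is mapped bijectively onto the set of edges incident with $f(\tilde v)$ (if $G$ has loops, this is applied to half-edges). -}

module Defs where

open import Level using (Level; _⊔_) renaming (suc to lsuc)
open import Data.Nat using (ℕ)
open import Data.Fin using (Fin)
open import Data.Product using (Σ; ∃; _×_; _,_)
open import Relation.Binary.PropositionalEquality using (_≡_; _≢_)

-- Graphs in the half-edge (dart) model, allowing loops, multiple edges
-- and semi-edges.  Each dart d is attached to the vertex  head d ;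
-- rev d is the other half of the same edge (rev d ≡ d for a semi-edge).
-- An edge is an orbit {d , rev d}.  A loop at v consists of two distinct
-- darts d , rev d both attached to v.
record Graph : Set₁ where
  field
    V       : Set
    D       : Set
    head    : D → V
    rev     : D → D
    rev-inv : ∀ d → rev (rev d) ≡ d

open Graph

record EdgeColouring (G : Graph) (n : ℕ) : Set where
  field
    col     : D G → Fin n
    col-rev : ∀ d → col (rev G d) ≡ col d

open EdgeColouring

Proper : {G : Graph} {n : ℕ} → EdgeColouring G n → Set
Proper {G} c =
  ∀ (x y : D G) → x ≢ y → head G x ≡ head G y → col c x ≢ col c y

-- No bichromatic path of length three: for every non-backtracking walk
-- e₁ e₂ e₃ of length three, e₁ and e₃ get different colours.
-- The walk: a is the half of e₁ at vertex v₁ = head a; b is the half of e₂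
-- at v₁ (b ≠ a); rev b is the half of e₂ at v₂; c is the half of e₃ at v₂
-- (c ≠ rev b).
NoBichromaticP3 : {G : Graph} {n : ℕ} → EdgeColouring G n → Set
NoBichromaticP3 {G} c =
  ∀ (a b d : D G) →
    b ≢ a → head G b ≡ head G a →
    d ≢ rev G b → head G d ≡ head G (rev G b) →
    col c a ≢ col c d

StrongEdgeColouring : (G : Graph) (n : ℕ) → Set
StrongEdgeColouring G n =
  Σ (EdgeColouring G n) λ c → Proper c × NoBichromaticP3 c

record CoveringProjection (G̃ G : Graph) : Set where
  field
    fV        : V G̃ → V G
    fD        : D G̃ → D G
    hom-head  : ∀ d → head G (fD d) ≡ fV (head G̃ d)
    hom-rev   : ∀ d → fD (rev G̃ d) ≡ rev G (fD d)
    surj      : ∀ v → ∃ λ ṽ → fV ṽ ≡ v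
    local-inj : ∀ x y → head G̃ x ≡ head G̃ y → fD x ≡ fD y → x ≡ y
    local-surj : ∀ ṽ d → head G d ≡ fV ṽ →
                 ∃ λ d̃ → head G̃ d̃ ≡ ṽ × fD d̃ ≡ d

{-# OPTIONS --safe #-}
-- Colour every dart of G̃ with the colour of its image in G.  A covering
-- projection is injective on the darts at each vertex, so two distinct darts
-- at a vertex of G̃, and a non-backtracking walk of length three in G̃, map to
-- the same kind of configuration in G; a colour clash upstairs would thus be
-- a clash downstairs.
module Submission where

open import Defs
open import Data.Nat using (ℕ)
open import Data.Product using (_,_)
open import Relation.Binary.PropositionalEquality
  using (_≡_; _≢_; sym; trans; cong)

open Graph
open EdgeColouring

record LocallyInjectiveHom (G̃ G : Graph) : Set where
  field
    fV        : V G̃ → V G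
    fD        : D G̃ → D G
    hom-head  : ∀ d → head G (fD d) ≡ fV (head G̃ d)
    hom-rev   : ∀ d → fD (rev G̃ d) ≡ rev G (fD d)
    local-inj : ∀ x y → head G̃ x ≡ head G̃ y → fD x ≡ fD y → x ≡ y

coveringProjection⇒locallyInjectiveHom : ∀ {G̃ G} →
  CoveringProjection G̃ G → LocallyInjectiveHom G̃ G
coveringProjection⇒locallyInjectiveHom f = record
  { fV        = fV
  ; fD        = fD
  ; hom-head  = hom-head
  ; hom-rev   = hom-rev
  ; local-inj = local-inj
  }
  where open CoveringProjection f

module Pullback {G̃ G : Graph} (f : LocallyInjectiveHom G̃ G) where

  open LocallyInjectiveHom f

  fD-resp-head : ∀ x y → head G̃ x ≡ head G̃ y → head G (fD x) ≡ head G (fD y)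
  fD-resp-head x y hx≡hy =
    trans (hom-head x) (trans (cong fV hx≡hy) (sym (hom-head y)))

  fD-injective-at-vertex : ∀ x y → head G̃ x ≡ head G̃ y → x ≢ y → fD x ≢ fD y
  fD-injective-at-vertex x y hx≡hy x≢y fx≡fy = x≢y (local-inj x y hx≡hy fx≡fy)

  pullback : ∀ {n} → EdgeColouring G n → EdgeColouring G̃ n
  col     (pullback c) d = col c (fD d)
  col-rev (pullback c) d = trans (cong (col c) (hom-rev d)) (col-rev c (fD d))

  pullback-proper : ∀ {n} {c : EdgeColouring G n} →
    Proper c → Proper (pullback c)
  pullback-proper proper x y x≢y hx≡hy =
    proper (fD x) (fD y) (fD-injective-at-vertex x y hx≡hy x≢y)
           (fD-resp-head x y hx≡hy)

  pullback-noBichromaticP3 : ∀ {n} {c : EdgeColouring G n} →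
    NoBichromaticP3 c → NoBichromaticP3 (pullback c)
  pullback-noBichromaticP3 noP3 a b d b≢a hb≡ha d≢rb hd≡hrb =
    noP3 (fD a) (fD b) (fD d)
         (fD-injective-at-vertex b a hb≡ha b≢a)
         (fD-resp-head b a hb≡ha)
         (λ fd≡rfb → fD-injective-at-vertex d (rev G̃ b) hd≡hrb d≢rb
                       (trans fd≡rfb (sym (hom-rev b))))
         (trans (fD-resp-head d (rev G̃ b) hd≡hrb) (cong (head G) (hom-rev b)))

  pullback-strong : ∀ {n} → StrongEdgeColouring G n → StrongEdgeColouring G̃ n
  pullback-strong (c , proper , noP3) =
    pullback c , pullback-proper {c = c} proper
               , pullback-noBichromaticP3 {c = c} noP3

lemma3 : (G̃ G : Graph) → CoveringProjection G̃ G → (n : ℕ) →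
    StrongEdgeColouring G n → StrongEdgeColouring G̃ n
lemma3 G̃ G f n = pullback-strong
  where open Pullback (coveringProjection⇒locallyInjectiveHom f)
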